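{- For $d\ge2$ and $n\ge0$, $$\big|S^{d-1}_n\big((21,12),231\big)\big|=\frac{1}{dn+1}\binom{dn+1}{n}.$$
   Context: A $d$-permutation of size $n$ is a tuple $\boldsymbol{\sigma}=(\sigma_1,\ldots,\sigma_{d-1})$ of permutations of $[n]$; put $\sigma_0=\mathrm{id}$. Its points are $(i,\sigma_1(i),\ldots,\sigma_{d-1}(i))$, $i\in[n]$, and $\sigma_l(p)$ is the $l$-th coordinate of point $p$. For indices $0\le i_1<\cdots<i_{d'}\le d-1$ the direct projection is $(\sigma_{i_2}\sigma_{i_1}^{ -1},\ldots,\sigma_{i_{d'}}\sigma_{i_1}^{ -1})$. $\boldsymbol\sigma$ contains a $d'$-permutation $\boldsymbol\tau$ of size $k$ if some direct projection $\boldsymbol\sigma'$ of dimension $d'$ and indices $c_1<\cdots<c_k$ have $\sigma'_m(c_1)\cdots\sigma'_m(c_k)$ order-isomorphic to $\tau_m$ for all $m$; else it avoids it. Concretely, $\boldsymbol\sigma$ contains the $3$-permutation $(21,12)$ iff there are points $p,q$ and $0\le i<j<k\le d-1$ with $\sigma_i(p)<\sigma_i(q)$, $\sigma_j(p)>\sigma_j(q)$, $\sigma_k(p)<\sigma_k(q)$; it contains $231$ iff there are $0\le i<j\le d-1$ and points $a,b,c$ with $\sigma_i(a)<\sigma_i(b)<\sigma_i(c)$ and $\sigma_j(c)<\sigma_j(a)<\sigma_j(b)$. $S^{d-1}_n((21,12),231)$ is the set of $d$-permutations of size $n$ avoiding both. -}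

module Defs where

open import Data.Nat using (ℕ; zero; suc; _∸_)
open import Data.Fin using (Fin; zero; suc; _<_)
open import Data.Vec using (Vec; lookup)
open import Data.Vec.Relation.Unary.All using (All)
open import Data.List using (List; length)
open import Data.List.Membership.Propositional using (_∈_)
open import Data.List.Relation.Unary.Unique.Propositional using (Unique)
open import Data.Product using (Σ; ∃; ∃-syntax; _×_)
open import Function.Bundles using (_⇔_)
open import Function.Definitions using (Injective)
open import Relation.Binary.PropositionalEquality using (_≡_)
open import Relation.Nullary using (¬_)

HasCard : {A : Set} → (A → Set) → ℕ → Set
HasCard {A} P N = Σ (List A) λ xs → Unique xs × (∀ x → x ∈ xs ⇔ P x) × length xs ≡ N

-- Raw data of a d-permutation of size n: the tuple (σ₁,…,σ_{d-1}),
-- each σ_l given by its table (σ_l(0),…,σ_l(n-1)); points indexed by Fin n.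
Tuple : ℕ → ℕ → Set
Tuple d n = Vec (Vec (Fin n) n) (d ∸ 1)

-- each entry is a permutation of [n] (injective self-map of a finite set)
IsDPerm : ∀ {d n} → Tuple d n → Set
IsDPerm {d} {n} σ = All (λ v → Injective _≡_ _≡_ (lookup v)) σ

coord : ∀ {d n} → Tuple d n → Fin (suc (d ∸ 1)) → Fin n → Fin n
coord σ zero p = p
coord σ (suc l) p = lookup (lookup σ l) p

Contains-21-12 : ∀ {d n} → Tuple d n → Set
Contains-21-12 {d} {n} σ =
  ∃[ p ] ∃[ q ] ∃[ i ] ∃[ j ] ∃[ k ]
    (i < j × j < k ×
     coord {d} σ i p < coord {d} σ i q ×
     coord {d} σ j q < coord {d} σ j p ×
     coord {d} σ k p < coord {d} σ k q)

Contains-231 : ∀ {d n} → Tuple d n → Set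
Contains-231 {d} {n} σ =
  ∃[ i ] ∃[ j ] ∃[ a ] ∃[ b ] ∃[ c ]
    (i < j ×
     coord {d} σ i a < coord {d} σ i b × coord {d} σ i b < coord {d} σ i c ×
     coord {d} σ j c < coord {d} σ j a × coord {d} σ j a < coord {d} σ j b)

InS : ∀ {d n} → Tuple d n → Set
InS {d} σ = IsDPerm {d} σ × ¬ Contains-21-12 {d} σ × ¬ Contains-231 {d} σ

-- A d-permutation avoiding (21,12) and 231 is the direct sum of blocks, each carrying a
-- d-ary tree.  In a nonempty block the point with the smallest first coordinate is the
-- root; say it sits at value ρ l in coordinate l.  Avoiding 231 makes the points below the
-- root in coordinate l an initial segment in the first coordinate, hence the first ρ l
-- points; avoiding (21,12) makes ρ monotone in l; together, every ρ l cuts the remaining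
-- points in all coordinates.  So removing the root splits its block into d consecutive
-- blocks, its subtrees, and conversely a root inserted at the cuts between d consecutive
-- blocks creates neither pattern.  The d-permutations of size n thus correspond to d-ary
-- trees with n nodes; forests of r such trees with n nodes in all number
-- r/(dn+r) · C(dn+r, n), by induction along the recurrence that splits off the first tree.

module Submission where

open import Defs
open import Data.Nat using (ℕ; zero; suc; pred; _+_; _*_; _∸_; _≤_; _<_; z≤n; s≤s; s≤s⁻¹; >-nonZero; _/_)
open import Data.Nat.Properties
open import Data.Nat.Combinatorics using (_C_; nC1≡n; nCk+nC[k+1]≡[n+1]C[k+1])
open import Data.Nat.DivMod using (m*n/n≡m)
open import Data.Nat.Tactic.RingSolver using (solve-∀)
open import Data.Fin as Fin using (Fin; zero; suc; toℕ; fromℕ<)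
open import Data.Fin.Properties using (toℕ<n; toℕ-fromℕ<; toℕ-injective; toℕ-inject≤; injective⇒≤)
  renaming (suc-injective to Fin-suc-injective)
open import Data.Empty using (⊥; ⊥-elim)
open import Data.List using (List; []; _∷_; _++_; map; length)
open import Data.List.Properties using (length-map; length-++)
open import Data.List.Membership.Propositional using (_∈_)
open import Data.List.Membership.Propositional.Properties using (∈-map⁺; ∈-map⁻; ∈-++⁺ˡ; ∈-++⁺ʳ)
open import Data.List.Relation.Unary.Any using (here)
open import Data.List.Relation.Unary.Unique.Propositional using (Unique)
import Data.List.Relation.Unary.Unique.Propositional.Properties as Unique
open import Data.List.Relation.Unary.All using ([])
open import Data.List.Relation.Unary.AllPairs using ([]; _∷_)
open import Data.Vec using (lookup; tabulate)
open import Data.Vec.Properties using (lookup∘tabulate)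
open import Data.Vec.Relation.Unary.All.Properties using (lookup⁺; lookup⁻)
open import Data.Vec.Relation.Binary.Pointwise.Extensional using (ext; Pointwise-≡⇒≡)
open import Function.Bundles using (mk⇔)
open import Data.Sum using (_⊎_; inj₁; inj₂; [_,_]′)
open import Data.Product using (Σ-syntax; ∃-syntax; _×_; _,_; proj₁; proj₂)
open import Function.Definitions using (Injective)
open import Relation.Binary.PropositionalEquality
open import Relation.Nullary using (¬_; contradiction)
open import Relation.Binary.Definitions using (tri<; tri≈; tri>)
open import Function using (id; _∘_)

punchIn : ℕ → ℕ → ℕ
punchIn zero    v       = suc v
punchIn (suc r) zero    = zero
punchIn (suc r) (suc v) = suc (punchIn r v)

punchOut : ℕ → ℕ → ℕ
punchOut zero    v       = pred v
punchOut (suc r) zero    = zero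
punchOut (suc r) (suc v) = suc (punchOut r v)

punchIn-≢ : ∀ r v → punchIn r v ≢ r
punchIn-≢ zero    v       ()
punchIn-≢ (suc r) zero    ()
punchIn-≢ (suc r) (suc v) eq = punchIn-≢ r v (suc-injective eq)

punchIn-injective : ∀ r {u v} → punchIn r u ≡ punchIn r v → u ≡ v
punchIn-injective zero                    eq = suc-injective eq
punchIn-injective (suc r) {zero}  {zero}  eq = refl
punchIn-injective (suc r) {suc u} {suc v} eq = cong suc (punchIn-injective r (suc-injective eq))

punchIn-mono-< : ∀ r {u v} → u < v → punchIn r u < punchIn r v
punchIn-mono-< zero                    u<v       = s≤s u<v
punchIn-mono-< (suc r) {zero}  {suc v} _         = s≤s z≤n
punchIn-mono-< (suc r) {suc u} {suc v} (s≤s u<v) = s≤s (punchIn-mono-< r u<v)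

punchIn-cancel-< : ∀ r {u v} → punchIn r u < punchIn r v → u < v
punchIn-cancel-< r {u} {v} lt with <-cmp u v
... | tri< u<v _ _ = u<v
... | tri≈ _ refl _ = ⊥-elim (<-irrefl refl lt)
... | tri> _ _ v<u = ⊥-elim (<-asym lt (punchIn-mono-< r v<u))

punchIn-below : ∀ {r v} → v < r → punchIn r v < r
punchIn-below {suc r} {zero}  _         = s≤s z≤n
punchIn-below {suc r} {suc v} (s≤s v<r) = s≤s (punchIn-below v<r)

punchIn-below⁻¹ : ∀ {r v} → punchIn r v < r → v < r
punchIn-below⁻¹ {suc r} {zero}  _   = s≤s z≤n
punchIn-below⁻¹ {suc r} {suc v} (s≤s lt) = s≤s (punchIn-below⁻¹ lt)

punchIn-above : ∀ {r v} → r ≤ v → r < punchIn r v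
punchIn-above {zero}          _         = s≤s z≤n
punchIn-above {suc r} {suc v} (s≤s r≤v) = s≤s (punchIn-above r≤v)

punchIn-above⁻¹ : ∀ {r v} → r < punchIn r v → r ≤ v
punchIn-above⁻¹ {zero}          _        = z≤n
punchIn-above⁻¹ {suc r} {suc v} (s≤s lt) = s≤s (punchIn-above⁻¹ lt)

punchIn≤suc : ∀ r v → punchIn r v ≤ suc v
punchIn≤suc zero    v       = ≤-refl
punchIn≤suc (suc r) zero    = z≤n
punchIn≤suc (suc r) (suc v) = s≤s (punchIn≤suc r v)

punchIn-<-suc : ∀ {r v C} → v < C → punchIn r v < suc C
punchIn-<-suc {r} {v} v<C = s≤s (≤-trans (punchIn≤suc r v) v<C)

punchIn-<-suc⁻¹ : ∀ {r v C} → r ≤ C → punchIn r v < suc C → v < C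
punchIn-<-suc⁻¹ {zero}          _         (s≤s lt) = lt
punchIn-<-suc⁻¹ {suc r} {zero}  (s≤s _)   _        = s≤s z≤n
punchIn-<-suc⁻¹ {suc r} {suc v} (s≤s r≤C) (s≤s lt) = s≤s (punchIn-<-suc⁻¹ r≤C lt)

punchIn-punchOut : ∀ {r v} → v ≢ r → punchIn r (punchOut r v) ≡ v
punchIn-punchOut {zero}  {zero}  v≢r = ⊥-elim (v≢r refl)
punchIn-punchOut {zero}  {suc v} _   = refl
punchIn-punchOut {suc r} {zero}  _   = refl
punchIn-punchOut {suc r} {suc v} v≢r = cong suc (punchIn-punchOut (v≢r ∘ cong suc))

injective-bounded⇒≤ : ∀ {a b} (f : Fin a → ℕ) → (∀ k → f k < b) → Injective _≡_ _≡_ f → a ≤ b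
injective-bounded⇒≤ f f<b f-inj = injective⇒≤ {f = λ k → fromℕ< (f<b k)} λ eq →
  f-inj (trans (sym (toℕ-fromℕ< _)) (trans (cong toℕ eq) (toℕ-fromℕ< _)))

module _ {n} {f : Fin n → ℕ} (f-inj : Injective _≡_ _≡_ f) where

  prefix-below⇒≤ : ∀ {a v} → a ≤ n → (∀ s → toℕ s < a → f s < v) → a ≤ v
  prefix-below⇒≤ {a} a≤n below = injective-bounded⇒≤ (f ∘ inject)
    (λ k → below (inject k) (subst (_< a) (sym (toℕ-inject≤ k a≤n)) (toℕ<n k)))
    (λ eq → toℕ-injective (trans (sym (toℕ-inject≤ _ a≤n)) (trans (cong toℕ (f-inj eq)) (toℕ-inject≤ _ a≤n))))
    where
      inject : Fin a → Fin n
      inject k = Fin.inject≤ k a≤n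

  suffix-above⇒≤ : ∀ {a v} → (∀ s → f s < n) → a < n → (∀ s → a ≤ toℕ s → v ≤ f s) → v ≤ a
  suffix-above⇒≤ {a} {v} f<n a<n above = ≮⇒≥ λ a<v → <⇒≱ (∸-monoʳ-< a<v v≤n) count
    where
      shift< : (k : Fin (n ∸ a)) → a + toℕ k < n
      shift< k = subst (a + toℕ k <_) (m+[n∸m]≡n (<⇒≤ a<n)) (+-monoʳ-< a (toℕ<n k))
      shift : Fin (n ∸ a) → Fin n
      shift k = fromℕ< (shift< k)
      toℕ-shift : ∀ k → toℕ (shift k) ≡ a + toℕ k
      toℕ-shift k = toℕ-fromℕ< (shift< k)
      v≤f-shift : ∀ k → v ≤ f (shift k)
      v≤f-shift k = above (shift k) (subst (a ≤_) (sym (toℕ-shift k)) (m≤m+n a (toℕ k)))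
      count : n ∸ a ≤ n ∸ v
      count = injective-bounded⇒≤ (λ k → f (shift k) ∸ v)
        (λ k → ∸-monoˡ-< (f<n (shift k)) (v≤f-shift k))
        (λ {k} {k′} eq → toℕ-injective (+-cancelˡ-≡ a _ _ (trans (sym (toℕ-shift k))
          (trans (cong toℕ (f-inj (∸-cancelʳ-≡ (v≤f-shift k) (v≤f-shift k′) eq))) (toℕ-shift k′)))))
      v≤n : v ≤ n
      v≤n = ≤-trans (v≤f-shift k₀) (<⇒≤ (f<n (shift k₀)))
        where k₀ = fromℕ< (m<n⇒0<n∸m a<n)

[1+k]*nC[1+k]+k*nCk≡n*nCk : ∀ n k → suc k * (n C suc k) + k * (n C k) ≡ n * (n C k)
[1+k]*nC[1+k]+k*nCk≡n*nCk zero    zero    = refl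
[1+k]*nC[1+k]+k*nCk≡n*nCk zero    (suc k) = cong₂ _+_ (*-zeroʳ (suc (suc k))) (*-zeroʳ (suc k))
[1+k]*nC[1+k]+k*nCk≡n*nCk (suc n) zero    = begin
  1 * (suc n C 1) + 0  ≡⟨ +-identityʳ _ ⟩
  1 * (suc n C 1)      ≡⟨ *-identityˡ _ ⟩
  suc n C 1            ≡⟨ nC1≡n (suc n) ⟩
  suc n                ≡⟨ *-identityʳ (suc n) ⟨
  suc n * 1            ∎
  where open ≡-Reasoning
[1+k]*nC[1+k]+k*nCk≡n*nCk (suc n) (suc k) = begin
  suc (suc k) * (suc n C suc (suc k)) + suc k * (suc n C suc k)
    ≡⟨ cong₂ (λ u w → suc (suc k) * u + suc k * w) (pascal (suc k)) (pascal k) ⟨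
  suc (suc k) * (y + z) + suc k * (x + y)
    ≡⟨ regroup k x y z ⟩
  (suc (suc k) * z + suc k * y) + (suc k * y + k * x) + (x + y)
    ≡⟨ cong₂ (λ u w → u + w + (x + y)) ([1+k]*nC[1+k]+k*nCk≡n*nCk n (suc k)) ([1+k]*nC[1+k]+k*nCk≡n*nCk n k) ⟩
  n * y + n * x + (x + y)
    ≡⟨ collect n x y ⟩
  suc n * (x + y)
    ≡⟨ cong (suc n *_) (pascal k) ⟩
  suc n * (suc n C suc k) ∎
  where
    open ≡-Reasoning
    x = n C k
    y = n C suc k
    z = n C suc (suc k)
    pascal : ∀ j → n C j + n C suc j ≡ suc n C suc j
    pascal = nCk+nC[k+1]≡[n+1]C[k+1] n
    regroup : ∀ k x y z → suc (suc k) * (y + z) + suc k * (x + y)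
                        ≡ (suc (suc k) * z + suc k * y) + (suc k * y + k * x) + (x + y)
    regroup = solve-∀
    collect : ∀ n x y → n * y + n * x + (x + y) ≡ suc n * (x + y)
    collect = solve-∀

infixr 5 _◃_

_◃_ : ℕ → (ℕ → ℕ) → ℕ → ℕ
(a ◃ f) zero    = a
(a ◃ f) (suc k) = f k

prepend : ∀ {m} → (Fin m → ℕ) → (ℕ → ℕ) → ℕ → ℕ
prepend {zero}  f g = g
prepend {suc m} f g = f zero ◃ prepend (f ∘ suc) g

prepend-low : ∀ {m} (f : Fin m → ℕ) g l → prepend f g (toℕ l) ≡ f l
prepend-low f g zero    = refl
prepend-low f g (suc l) = prepend-low (f ∘ suc) g l

prepend-high : ∀ m (f : Fin m → ℕ) g k → prepend f g (m + k) ≡ g k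
prepend-high zero    f g k = refl
prepend-high (suc m) f g k = prepend-high m (f ∘ suc) g k

data Split (m : ℕ) : ℕ → Set where
  low  : (l : Fin m) → Split m (toℕ l)
  high : (k : ℕ) → Split m (m + k)

split : ∀ m k → Split m k
split zero    k       = high k
split (suc m) zero    = low zero
split (suc m) (suc k) with split m k
... | low l  = low (suc l)
... | high j = high j

HasCard-image : ∀ {A B : Set} {P : B → Set} (f : A → B) {xs : List A} → Injective _≡_ _≡_ f → Unique xs
  → (∀ a → a ∈ xs) → (∀ a → P (f a)) → (∀ {b} → P b → ∃[ a ] f a ≡ b) → HasCard P (length xs)
HasCard-image {P = P} f {xs} f-inj xs-unique ∈xs P-image image-P =
  map f xs , Unique.map⁺ f-inj xs-unique , (λ b → mk⇔ (to b) from) , length-map f xs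
  where
    to : ∀ b → b ∈ map f xs → P b
    to b b∈ with ∈-map⁻ f b∈
    ... | a , _ , refl = P-image a
    from : ∀ {b} → P b → b ∈ map f xs
    from Pb with image-P Pb
    ... | a , refl = ∈-map⁺ f (∈xs a)

module _ (e : ℕ) where

  d : ℕ
  d = suc e

  -- Counting forests

  -- A list of r possibly empty d-ary trees with n nodes in all.  The first tree is
  -- either empty, or a node whose d subtrees are the first d trees of the rest.
  data Forest : ℕ → ℕ → Set where
    nil  : Forest 0 0
    leaf : ∀ {n r} → Forest n r → Forest n (suc r)
    node : ∀ {n r} → Forest n (d + r) → Forest (suc n) (suc r)

  forests : (n r : ℕ) → List (Forest n r)
  forests zero    zero    = nil ∷ []
  forests (suc n) zero    = []
  forests zero    (suc r) = map leaf (forests zero r)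
  forests (suc n) (suc r) = map leaf (forests (suc n) r) ++ map node (forests n (d + r))

  ∈-forests : ∀ {n r} (F : Forest n r) → F ∈ forests n r
  ∈-forests nil              = here refl
  ∈-forests {zero}  (leaf F) = ∈-map⁺ leaf (∈-forests F)
  ∈-forests {suc n} (leaf F) = ∈-++⁺ˡ (∈-map⁺ leaf (∈-forests F))
  ∈-forests (node F)         = ∈-++⁺ʳ (map leaf (forests _ _)) (∈-map⁺ node (∈-forests F))

  leaf-injective : ∀ {n r} {F G : Forest n r} → leaf F ≡ leaf G → F ≡ G
  leaf-injective refl = refl

  node-injective : ∀ {n r} {F G : Forest n (d + r)} → node F ≡ node G → F ≡ G
  node-injective refl = refl

  forests-unique : ∀ n r → Unique (forests n r)
  forests-unique zero    zero    = [] ∷ []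
  forests-unique (suc n) zero    = []
  forests-unique zero    (suc r) = Unique.map⁺ leaf-injective (forests-unique zero r)
  forests-unique (suc n) (suc r) = Unique.++⁺ (Unique.map⁺ leaf-injective (forests-unique (suc n) r))
    (Unique.map⁺ node-injective (forests-unique n (d + r))) leaves-disjoint-nodes
    where
      leaves-disjoint-nodes : ∀ {H} → ¬ (H ∈ map leaf (forests (suc n) r) × H ∈ map node (forests n (d + r)))
      leaves-disjoint-nodes (l , m) with ∈-map⁻ leaf l | ∈-map⁻ node m
      ... | _ , _ , refl | _ , _ , ()

  forestCount : ℕ → ℕ → ℕ
  forestCount zero    _       = 1
  forestCount (suc n) zero    = 0
  forestCount (suc n) (suc r) = forestCount (suc n) r + forestCount n (d + r)

  length-forests : ∀ n r → length (forests n r) ≡ forestCount n r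
  length-forests zero    zero    = refl
  length-forests (suc n) zero    = refl
  length-forests zero    (suc r) = trans (length-map leaf (forests zero r)) (length-forests zero r)
  length-forests (suc n) (suc r) = begin
    length (map leaf (forests (suc n) r) ++ map node (forests n (d + r)))
      ≡⟨ length-++ (map leaf (forests (suc n) r)) ⟩
    length (map leaf (forests (suc n) r)) + length (map node (forests n (d + r)))
      ≡⟨ cong₂ _+_ (length-map leaf (forests (suc n) r)) (length-map node (forests n (d + r))) ⟩
    length (forests (suc n) r) + length (forests n (d + r))
      ≡⟨ cong₂ _+_ (length-forests (suc n) r) (length-forests n (d + r)) ⟩
    forestCount (suc n) (suc r) ∎
    where open ≡-Reasoning

  forestCount-step : ∀ n r
    → forestCount (suc n) r * (d * suc n + r) ≡ r * ((d * suc n + r) C suc n)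
    → forestCount n (d + r) * (d * n + (d + r)) ≡ (d + r) * ((d * n + (d + r)) C n)
    → forestCount (suc n) (suc r) * (d * suc n + suc r) ≡ suc r * ((d * suc n + suc r) C suc n)
  forestCount-step n r IH₁ IH₂ = begin
    (A₁ + A₂) * (d * suc n + suc r)          ≡⟨ cong ((A₁ + A₂) *_) (+-suc (d * suc n) r) ⟩
    (A₁ + A₂) * suc M                        ≡⟨ *-cancelˡ-≡ _ _ M scaled ⟩
    suc r * (a + b)                          ≡⟨ cong (suc r *_) (nCk+nC[k+1]≡[n+1]C[k+1] M n) ⟩
    suc r * (suc M C suc n)                  ≡⟨ cong (λ m → suc r * (m C suc n)) (+-suc (d * suc n) r) ⟨
    suc r * ((d * suc n + suc r) C suc n)    ∎
    where
      open ≡-Reasoning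
      M = d * suc n + r
      A₁ = forestCount (suc n) r
      A₂ = forestCount n (d + r)
      a = M C n
      b = M C suc n
      shift : ∀ e n r → suc e * n + (suc e + r) ≡ suc e * suc n + r
      shift = solve-∀
      IH₂′ : A₂ * M ≡ (d + r) * a
      IH₂′ = subst (λ m → A₂ * m ≡ (d + r) * (m C n)) (shift e n r) IH₂
      -- combined, with d times the absorption identity added so that no subtraction occurs
      polynomial : ∀ e n r a b → (r * b + (suc e + r) * a) * suc (suc e * suc n + r) + suc e * (suc n * b + n * a)
                 ≡ (suc e * suc n + r) * (suc r * (a + b)) + suc e * ((suc e * suc n + r) * a)
      polynomial = solve-∀
      combined : (r * b + (d + r) * a) * suc M ≡ M * (suc r * (a + b))
      combined = +-cancelʳ-≡ (d * (M * a)) _ _ (begin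
        (r * b + (d + r) * a) * suc M + d * (M * a)
          ≡⟨ cong (λ t → (r * b + (d + r) * a) * suc M + d * t) ([1+k]*nC[1+k]+k*nCk≡n*nCk M n) ⟨
        (r * b + (d + r) * a) * suc M + d * (suc n * b + n * a)
          ≡⟨ polynomial e n r a b ⟩
        M * (suc r * (a + b)) + d * (M * a) ∎)
      distribute : ∀ M A₁ A₂ → M * ((A₁ + A₂) * suc M) ≡ (A₁ * M + A₂ * M) * suc M
      distribute = solve-∀
      scaled : M * ((A₁ + A₂) * suc M) ≡ M * (suc r * (a + b))
      scaled = begin
        M * ((A₁ + A₂) * suc M)           ≡⟨ distribute M A₁ A₂ ⟩
        (A₁ * M + A₂ * M) * suc M         ≡⟨ cong₂ (λ u w → (u + w) * suc M) IH₁ IH₂′ ⟩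
        (r * b + (d + r) * a) * suc M     ≡⟨ combined ⟩
        M * (suc r * (a + b))             ∎

  forestCount-closed : ∀ n r → forestCount n r * (d * n + r) ≡ r * ((d * n + r) C n)
  forestCount-closed zero    r       = base e r
    where
      base : ∀ e r → 1 * (suc e * 0 + r) ≡ r * 1
      base = solve-∀
  forestCount-closed (suc n) zero    = refl
  forestCount-closed (suc n) (suc r) =
    forestCount-step n r (forestCount-closed (suc n) r) (forestCount-closed n (d + r))

  forestCount-formula : ∀ n → forestCount n 1 ≡ ((d * n + 1) C n) / suc (d * n)
  forestCount-formula n = sym (begin
    ((d * n + 1) C n) / suc (d * n)               ≡⟨ cong (λ m → (m C n) / suc (d * n)) (+-comm (d * n) 1) ⟩
    (suc (d * n) C n) / suc (d * n)               ≡⟨ cong (_/ suc (d * n)) (sym (trans closed (*-identityˡ _))) ⟩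
    forestCount n 1 * suc (d * n) / suc (d * n)   ≡⟨ m*n/n≡m (forestCount n 1) (suc (d * n)) ⟩
    forestCount n 1                               ∎)
    where
      open ≡-Reasoning
      closed : forestCount n 1 * suc (d * n) ≡ 1 * (suc (d * n) C n)
      closed = subst (λ m → forestCount n 1 * m ≡ 1 * (m C n)) (+-comm (d * n) 1) (forestCount-closed n 1)

  -- Block decompositions of d-permutations

  toℕ≤d+ : ∀ (l : Fin d) k → toℕ l ≤ d + k
  toℕ≤d+ l k = ≤-trans (<⇒≤ (toℕ<n l)) (m≤m+n d k)

  Coords : ℕ → Set
  Coords n = Fin d → Fin n → ℕ

  _≗ᶜ_ : ∀ {n} → Coords n → Coords n → Set
  x ≗ᶜ x′ = ∀ l i → x l i ≡ x′ l i

  Contains2112 : ∀ {n} → Coords n → Set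
  Contains2112 x = ∃[ p ] ∃[ q ] ∃[ i ] ∃[ j ] ∃[ k ]
    (i Fin.< j × j Fin.< k × x i p < x i q × x j q < x j p × x k p < x k q)

  Contains231 : ∀ {n} → Coords n → Set
  Contains231 x = ∃[ i ] ∃[ j ] ∃[ a ] ∃[ b ] ∃[ c ]
    (i Fin.< j × x i a < x i b × x i b < x i c × x j c < x j a × x j a < x j b)

  record Avoiding {n} (x : Coords n) : Set where
    field
      row₀        : ∀ i → x zero i ≡ toℕ i
      injective   : ∀ l → Injective _≡_ _≡_ (x l)
      bounded     : ∀ l i → x l i < n
      avoids-2112 : ¬ Contains2112 x
      avoids-231  : ¬ Contains231 x

    row₀-< : ∀ {i j} → toℕ i < toℕ j → x zero i < x zero j
    row₀-< {i} {j} = subst₂ _<_ (sym (row₀ i)) (sym (row₀ j))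

    compare : ∀ l {s t} → toℕ s < toℕ t → x l s < x l t ⊎ x l t < x l s
    compare l {s} {t} s<t with <-cmp (x l s) (x l t)
    ... | tri< lt _ _ = inj₁ lt
    ... | tri≈ _ eq _ = ⊥-elim (<-irrefl (cong toℕ (injective l eq)) s<t)
    ... | tri> _ _ gt = inj₂ gt

  IsCut : ∀ {n} → Coords n → ℕ → Set
  IsCut x b = ∀ l i → (x l i < b → toℕ i < b) × (toℕ i < b → x l i < b)

  IsCut-zero : ∀ {n} (x : Coords n) → IsCut x 0
  IsCut-zero x l i = (λ ()) , (λ ())

  -- The cuts c 0 ≤ c 1 ≤ ⋯ ≤ c r split x into r consecutive, possibly empty blocks:
  -- x is the direct sum of the d-permutations they carry.
  record Cuts {n} (r : ℕ) (x : Coords n) (c : ℕ → ℕ) : Set where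
    field
      first : c 0 ≡ 0
      last  : c r ≡ n
      mono  : ∀ {j k} → j ≤ k → k ≤ r → c j ≤ c k
      cut   : ∀ {k} → k ≤ r → IsCut x (c k)

  Cuts-emptyBlock⁺ : ∀ {n r} {x : Coords n} {c} → Cuts r x c → Cuts (suc r) x (0 ◃ c)
  Cuts-emptyBlock⁺ {x = x} cs = record
    { first = refl
    ; last  = last
    ; mono  = λ { {zero} _ _ → z≤n ; {suc j} {suc k} (s≤s j≤k) (s≤s k≤r) → mono j≤k k≤r }
    ; cut   = λ { {zero} _ → IsCut-zero x ; {suc k} (s≤s k≤r) → cut k≤r }
    }
    where open Cuts cs

  Cuts-emptyBlock⁻ : ∀ {n r} {x : Coords n} {c} → Cuts (suc r) x c → c 1 ≡ 0 → Cuts r x (c ∘ suc)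
  Cuts-emptyBlock⁻ cs c₁≡0 = record
    { first = c₁≡0
    ; last  = last
    ; mono  = λ j≤k k≤r → mono (s≤s j≤k) (s≤s k≤r)
    ; cut   = λ k≤r → cut (s≤s k≤r)
    }
    where open Cuts cs

  Avoiding-resp : ∀ {n} {x x′ : Coords n} → x ≗ᶜ x′ → Avoiding x → Avoiding x′
  Avoiding-resp {x = x} {x′} x≗x′ x-avoiding = record
    { row₀        = λ i → trans (sym (x≗x′ zero i)) (row₀ i)
    ; injective   = λ l eq → injective l (trans (x≗x′ l _) (trans eq (sym (x≗x′ l _))))
    ; bounded     = λ l i → subst (_< _) (x≗x′ l i) (bounded l i)
    ; avoids-2112 = λ { (p , q , i , j , k , i<j , j<k , h₁ , h₂ , h₃) →
                        avoids-2112 (p , q , i , j , k , i<j , j<k , back h₁ , back h₂ , back h₃) }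
    ; avoids-231  = λ { (i , j , a , b , c , i<j , h₁ , h₂ , h₃ , h₄) →
                        avoids-231 (i , j , a , b , c , i<j , back h₁ , back h₂ , back h₃ , back h₄) }
    }
    where
      open Avoiding x-avoiding
      back : ∀ {l i j} → x′ l i < x′ l j → x l i < x l j
      back = subst₂ _<_ (sym (x≗x′ _ _)) (sym (x≗x′ _ _))

  Cuts-resp : ∀ {n r c} {x x′ : Coords n} → x ≗ᶜ x′ → Cuts r x c → Cuts r x′ c
  Cuts-resp x≗x′ x-cuts = record
    { first = first
    ; last  = last
    ; mono  = mono
    ; cut   = λ k≤r l i → (λ lt → proj₁ (cut k≤r l i) (subst (_< _) (sym (x≗x′ l i)) lt))
                        , (λ lt → subst (_< _) (x≗x′ l i) (proj₂ (cut k≤r l i) lt))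
    }
    where open Cuts x-cuts

  insertRoot : ∀ {n} → (Fin d → ℕ) → Coords n → Coords (suc n)
  insertRoot ρ y l zero    = ρ l
  insertRoot ρ y l (suc i) = punchIn (ρ l) (y l i)

  removeRoot : ∀ {n} → Coords (suc n) → Coords n
  removeRoot x l i = punchOut (x l zero) (x l (suc i))

  reinsertRoot : ∀ {n} {x : Coords (suc n)} → Avoiding x → x ≗ᶜ insertRoot (λ l → x l zero) (removeRoot x)
  reinsertRoot x-avoiding l zero    = refl
  reinsertRoot x-avoiding l (suc i) = sym (punchIn-punchOut λ eq → contradiction (Avoiding.injective x-avoiding l eq) λ ())

  module _ {n} (ρ : Fin d → ℕ) (y : Coords n) where

    insertRoot-2112 : Contains2112 y → Contains2112 (insertRoot ρ y)
    insertRoot-2112 (p , q , i , j , k , i<j , j<k , h₁ , h₂ , h₃) =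
      suc p , suc q , i , j , k , i<j , j<k , punchIn-mono-< (ρ i) h₁ , punchIn-mono-< (ρ j) h₂ , punchIn-mono-< (ρ k) h₃

    insertRoot-231 : Contains231 y → Contains231 (insertRoot ρ y)
    insertRoot-231 (i , j , a , b , c , i<j , h₁ , h₂ , h₃ , h₄) =
      i , j , suc a , suc b , suc c , i<j
      , punchIn-mono-< (ρ i) h₁ , punchIn-mono-< (ρ i) h₂ , punchIn-mono-< (ρ j) h₃ , punchIn-mono-< (ρ j) h₄

    insertRoot-cut : ∀ {C} → (∀ l → ρ l ≤ C) → IsCut y C → IsCut (insertRoot ρ y) (suc C)
    insertRoot-cut ρ≤C y-cut l zero    = (λ _ → s≤s z≤n) , (λ _ → s≤s (ρ≤C l))
    insertRoot-cut ρ≤C y-cut l (suc t) =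
        (λ lt → s≤s (proj₁ (y-cut l t) (punchIn-<-suc⁻¹ (ρ≤C l) lt)))
      , (λ t<C → punchIn-<-suc (proj₂ (y-cut l t) (s≤s⁻¹ t<C)))

    insertRoot-cut⁻¹ : ∀ {C} → (∀ l → ρ l ≤ C) → IsCut (insertRoot ρ y) (suc C) → IsCut y C
    insertRoot-cut⁻¹ ρ≤C x-cut l t =
        (λ lt → s≤s⁻¹ (proj₁ (x-cut l (suc t)) (punchIn-<-suc lt)))
      , (λ t<C → punchIn-<-suc⁻¹ (ρ≤C l) (proj₂ (x-cut l (suc t)) (s≤s t<C)))

  -- From forests to d-permutations

  cuts : ∀ {n r} → Forest n r → ℕ → ℕ
  cuts nil      = λ _ → 0
  cuts (leaf F) = 0 ◃ cuts F
  cuts (node F) = 0 ◃ λ k → suc (cuts F (d + k))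

  -- The root of a tree goes, in coordinate l, right after the points of its first l subtrees.
  coords : ∀ {n r} → Forest n r → Coords n
  coords nil      _ ()
  coords (leaf F) = coords F
  coords (node F) = insertRoot (λ l → cuts F (toℕ l)) (coords F)

  module NodeSoundness {n r} {y : Coords n} {c : ℕ → ℕ} (y-cuts : Cuts (d + r) y c) where
    open Cuts y-cuts

    ρ : Fin d → ℕ
    ρ l = c (toℕ l)

    x : Coords (suc n)
    x = insertRoot ρ y

    root-mono : ∀ {j k} → toℕ j ≤ toℕ k → ρ j ≤ ρ k
    root-mono {k = k} j≤k = mono j≤k (toℕ≤d+ k r)

    root-cut : ∀ l → IsCut y (ρ l)
    root-cut l = cut (toℕ≤d+ l r)

    below-root⇒index : ∀ l t → x l (suc t) < ρ l → toℕ t < ρ l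
    below-root⇒index l t lt = proj₁ (root-cut l l t) (punchIn-below⁻¹ lt)

    above-root⇒index : ∀ l t → ρ l < x l (suc t) → ρ l ≤ toℕ t
    above-root⇒index l t gt = ≮⇒≥ λ t<ρ → <⇒≱ (proj₂ (root-cut l l t) t<ρ) (punchIn-above⁻¹ gt)

    ¬below-then-above-root : ∀ {i j} → toℕ i ≤ toℕ j → ∀ t → x i (suc t) < ρ i → ρ j < x j (suc t) → ⊥
    ¬below-then-above-root i≤j t lt gt =
      <⇒≱ (below-root⇒index _ t lt) (≤-trans (root-mono i≤j) (above-root⇒index _ t gt))

    root-cut-downward : ∀ l l′ {u w} → y l′ u < y l′ w → toℕ w < ρ l → toℕ u < ρ l
    root-cut-downward l l′ {u} {w} lt w<ρ = proj₁ (root-cut l l′ u) (<-trans lt (proj₂ (root-cut l l′ w) w<ρ))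

    node-cuts : Cuts (suc r) x (0 ◃ λ k → suc (c (d + k)))
    node-cuts = record
      { first = refl
      ; last  = cong suc last
      ; mono  = λ { {zero} _ _ → z≤n
                  ; {suc j} {suc k} (s≤s j≤k) (s≤s k≤r) → s≤s (mono (+-monoʳ-≤ d j≤k) (+-monoʳ-≤ d k≤r)) }
      ; cut   = λ { {zero} _ → IsCut-zero x
                  ; {suc k} (s≤s k≤r) →
                      insertRoot-cut ρ y (λ l → mono (toℕ≤d+ l k) (+-monoʳ-≤ d k≤r)) (cut (+-monoʳ-≤ d k≤r)) }
      }

    node-avoiding : Avoiding y → Avoiding x
    node-avoiding y-avoiding = record
      { row₀        = λ { zero → first ; (suc t) → cong₂ punchIn first (row₀ t) }
      ; injective   = injective′
      ; bounded     = λ { l zero → s≤s (subst (ρ l ≤_) last (mono (toℕ≤d+ l r) ≤-refl))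
                        ; l (suc t) → punchIn-<-suc (bounded l t) }
      ; avoids-2112 = avoids-2112′
      ; avoids-231  = avoids-231′
      }
      where
        open Avoiding y-avoiding

        injective′ : ∀ l → Injective _≡_ _≡_ (x l)
        injective′ l {zero}  {zero}  _  = refl
        injective′ l {zero}  {suc t} eq = ⊥-elim (punchIn-≢ _ _ (sym eq))
        injective′ l {suc s} {zero}  eq = ⊥-elim (punchIn-≢ _ _ eq)
        injective′ l {suc s} {suc t} eq = cong suc (injective l (punchIn-injective (ρ l) eq))

        avoids-2112′ : ¬ Contains2112 x
        avoids-2112′ (zero  , zero  , _ , _ , _ , _ , _ , h₁ , _) = <-irrefl refl h₁
        avoids-2112′ (zero  , suc t , _ , _ , _ , _ , j<k , _ , h₂ , h₃) = ¬below-then-above-root (<⇒≤ j<k) t h₂ h₃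
        avoids-2112′ (suc t , zero  , _ , _ , _ , i<j , _ , h₁ , h₂ , _) = ¬below-then-above-root (<⇒≤ i<j) t h₁ h₂
        avoids-2112′ (suc s , suc t , i , j , k , i<j , j<k , h₁ , h₂ , h₃) = avoids-2112
          (s , t , i , j , k , i<j , j<k , punchIn-cancel-< (ρ i) h₁ , punchIn-cancel-< (ρ j) h₂ , punchIn-cancel-< (ρ k) h₃)

        avoids-231′ : ¬ Contains231 x
        avoids-231′ (_ , _ , zero   , zero   , _      , _ , h₁ , _) = <-irrefl refl h₁
        avoids-231′ (_ , _ , zero   , suc _  , zero   , _ , h₁ , h₂ , _) = <-irrefl refl (<-trans h₁ h₂)
        avoids-231′ (_ , _ , suc _  , zero   , zero   , _ , _ , h₂ , _) = <-irrefl refl h₂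
        avoids-231′ (i , j , zero   , suc tb , suc tc , _ , _ , h₂ , h₃ , h₄) =
          <⇒≱ (root-cut-downward j i (punchIn-cancel-< (ρ i) h₂) (below-root⇒index j tc h₃)) (above-root⇒index j tb h₄)
        avoids-231′ (i , j , suc ta , zero   , suc tc , _ , h₁ , h₂ , h₃ , _) =
          <⇒≱ (root-cut-downward i j (punchIn-cancel-< (ρ j) h₃) (below-root⇒index i ta h₁)) (above-root⇒index i tc h₂)
        avoids-231′ (_ , _ , suc ta , suc _  , zero   , i<j , h₁ , h₂ , h₃ , _) =
          ¬below-then-above-root (<⇒≤ i<j) ta (<-trans h₁ h₂) h₃
        avoids-231′ (i , j , suc ta , suc tb , suc tc , i<j , h₁ , h₂ , h₃ , h₄) = avoids-231
          (i , j , ta , tb , tc , i<j , punchIn-cancel-< (ρ i) h₁ , punchIn-cancel-< (ρ i) h₂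
          , punchIn-cancel-< (ρ j) h₃ , punchIn-cancel-< (ρ j) h₄)

  forest-cuts : ∀ {n r} (F : Forest n r) → Cuts r (coords F) (cuts F)
  forest-cuts nil      = record { first = refl ; last = refl ; mono = λ _ _ → z≤n ; cut = λ _ _ () }
  forest-cuts (leaf F) = Cuts-emptyBlock⁺ (forest-cuts F)
  forest-cuts (node F) = NodeSoundness.node-cuts (forest-cuts F)

  forest-avoiding : ∀ {n r} (F : Forest n r) → Avoiding (coords F)
  forest-avoiding nil      = record
    { row₀ = λ () ; injective = λ { _ {()} } ; bounded = λ _ ()
    ; avoids-2112 = λ () ; avoids-231 = λ { (_ , _ , () , _) } }
  forest-avoiding (leaf F) = forest-avoiding F
  forest-avoiding (node F) = NodeSoundness.node-avoiding (forest-cuts F) (forest-avoiding F)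

  forest-injective : ∀ {n r} (F G : Forest n r)
    → coords F ≗ᶜ coords G → (∀ {k} → k ≤ r → cuts F k ≡ cuts G k) → F ≡ G
  forest-injective nil      nil      _           _         = refl
  forest-injective (leaf F) (leaf G) same-coords same-cuts = cong leaf (forest-injective F G same-coords (same-cuts ∘ s≤s))
  forest-injective (leaf F) (node G) _           same-cuts =
    ⊥-elim (0≢1+n (trans (sym (Cuts.first (forest-cuts F))) (same-cuts (s≤s z≤n))))
  forest-injective (node F) (leaf G) _           same-cuts =
    ⊥-elim (0≢1+n (trans (sym (Cuts.first (forest-cuts G))) (sym (same-cuts (s≤s z≤n)))))
  forest-injective {r = suc r} (node F) (node G) same-coords same-cuts = cong node (forest-injective F G same-coords′ same-cuts′)
    where
      same-root : ∀ l → cuts F (toℕ l) ≡ cuts G (toℕ l)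
      same-root l = same-coords l zero
      same-coords′ : coords F ≗ᶜ coords G
      same-coords′ l i = punchIn-injective (cuts F (toℕ l))
        (trans (same-coords l (suc i)) (cong (λ ρ → punchIn ρ (coords G l i)) (sym (same-root l))))
      same-cuts′ : ∀ {k} → k ≤ d + r → cuts F k ≡ cuts G k
      same-cuts′ {k} k≤d+r with split d k
      ... | low l  = same-root l
      ... | high j = suc-injective (same-cuts (s≤s (+-cancelˡ-≤ d j r k≤d+r)))

  -- From d-permutations to forests

  Represents : ∀ {n r} → Forest n r → Coords n → (ℕ → ℕ) → Set
  Represents {r = r} F x c = coords F ≗ᶜ x × (∀ {k} → k ≤ r → cuts F k ≡ c k)

  module RootRemoval {n r} {ρ : Fin d → ℕ} {y : Coords n} {c : ℕ → ℕ}
      (x-avoiding : Avoiding (insertRoot ρ y)) (x-cuts : Cuts (suc r) (insertRoot ρ y) c) (c₁>0 : 0 < c 1) where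
    open Avoiding x-avoiding
    open Cuts x-cuts

    root₀ : ρ zero ≡ 0
    root₀ = row₀ zero

    root<c₁ : ∀ l → ρ l < c 1
    root<c₁ l = proj₂ (cut (s≤s z≤n) l zero) c₁>0

    root≤n : ∀ l → ρ l ≤ n
    root≤n l = s≤s⁻¹ (<-≤-trans (root<c₁ l) (subst (c 1 ≤_) last (mono (s≤s z≤n) ≤-refl)))

    y-avoiding : Avoiding y
    y-avoiding = record
      { row₀        = λ i → suc-injective (trans (cong (λ ρ₀ → punchIn ρ₀ (y zero i)) (sym root₀)) (row₀ (suc i)))
      ; injective   = λ l eq → Fin-suc-injective (injective l (cong (punchIn (ρ l)) eq))
      ; bounded     = λ l i → punchIn-<-suc⁻¹ (root≤n l) (bounded l (suc i))
      ; avoids-2112 = avoids-2112 ∘ insertRoot-2112 ρ y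
      ; avoids-231  = avoids-231 ∘ insertRoot-231 ρ y
      }

    module Y = Avoiding y-avoiding

    below-root-downward : ∀ l {s t} → toℕ s < toℕ t → y l t < ρ l → y l s < ρ l
    below-root-downward zero    _                 yt<ρ = ⊥-elim (n≮0 (subst (_ <_) root₀ yt<ρ))
    below-root-downward (suc l) {s} {t} s<t yt<ρ = ≰⇒> λ ρ≤ys → avoids-231
      (zero , suc l , zero , suc s , suc t , s≤s z≤n
      , row₀-< (s≤s z≤n) , row₀-< (s≤s s<t) , punchIn-below yt<ρ , punchIn-above ρ≤ys)

    below-root-closed : ∀ l {s t} → toℕ s ≤ toℕ t → y l t < ρ l → y l s < ρ l
    below-root-closed l {s} {t} s≤t yt<ρ with m≤n⇒m<n∨m≡n s≤t
    ... | inj₁ s<t = below-root-downward l s<t yt<ρ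
    ... | inj₂ s≡t rewrite toℕ-injective s≡t = yt<ρ

    above-root-closed : ∀ l {s t} → toℕ s ≤ toℕ t → ρ l ≤ y l s → ρ l ≤ y l t
    above-root-closed l s≤t ρ≤ys = ≮⇒≥ λ yt<ρ → <⇒≱ (below-root-closed l s≤t yt<ρ) ρ≤ys

    below-root⇒index : ∀ l t → y l t < ρ l → toℕ t < ρ l
    below-root⇒index l t yt<ρ =
      prefix-below⇒≤ (Y.injective l) (toℕ<n t) λ s s≤t → below-root-closed l (s≤s⁻¹ s≤t) yt<ρ

    index⇒below-root : ∀ l t → toℕ t < ρ l → y l t < ρ l
    index⇒below-root l t t<ρ = ≰⇒> λ ρ≤yt →
      <⇒≱ t<ρ (suffix-above⇒≤ (Y.injective l) (Y.bounded l) (toℕ<n t) λ s t≤s → above-root-closed l t≤s ρ≤yt)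

    below-root : ∀ l {t} → toℕ t < ρ l → insertRoot ρ y l (suc t) < ρ l
    below-root l t<ρ = punchIn-below (index⇒below-root l _ t<ρ)

    above-root : ∀ l {t} → ρ l ≤ toℕ t → ρ l < insertRoot ρ y l (suc t)
    above-root l ρ≤t = punchIn-above (≮⇒≥ λ yt<ρ → <⇒≱ (below-root⇒index l _ yt<ρ) ρ≤t)

    root-mono : ∀ {j k} → toℕ j ≤ toℕ k → ρ j ≤ ρ k
    root-mono {zero} {k} _   = subst (_≤ ρ k) (sym root₀) z≤n
    root-mono {suc j} {k} j≤k = ≮⇒≥ λ ρk<ρj →
      let t<n = <-≤-trans ρk<ρj (root≤n (suc j))
          t   = fromℕ< t<n
          t≡ρk : toℕ t ≡ ρ k
          t≡ρk = toℕ-fromℕ< t<n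
      in avoids-2112 (zero , suc t , zero , suc j , k , s≤s z≤n
         , ≤∧≢⇒< j≤k (λ j≡k → <-irrefl (cong ρ (toℕ-injective (sym j≡k))) ρk<ρj)
         , row₀-< (s≤s z≤n)
         , below-root (suc j) (subst (_< ρ (suc j)) (sym t≡ρk) ρk<ρj)
         , above-root k (≤-reflexive (sym t≡ρk)))

    ¬crossing-earlier : ∀ {l l′ s t} → toℕ l′ < toℕ l → toℕ s < ρ l → ρ l ≤ toℕ t → ¬ y l′ t < y l′ s
    ¬crossing-earlier {l′ = zero} _ s<ρ ρ≤t = <-asym (Y.row₀-< (<-≤-trans s<ρ ρ≤t))
    ¬crossing-earlier {l} {suc l′} {s} {t} l′<l s<ρ ρ≤t yt<ys = avoids-2112
      (suc s , suc t , zero , suc l′ , l , s≤s z≤n , l′<l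
      , row₀-< (s≤s (<-≤-trans s<ρ ρ≤t)) , punchIn-mono-< (ρ (suc l′)) yt<ys , <-trans (below-root l s<ρ) (above-root l ρ≤t))

    ¬crossing-later : ∀ {l l′ s t} → toℕ l ≤ toℕ l′ → toℕ s < ρ l → ρ l ≤ toℕ t → ¬ y l′ t < y l′ s
    ¬crossing-later {l} {l′} {s} {t} l≤l′ s<ρ ρ≤t yt<ys = [ crossing-231 , same-row ]′ (m≤n⇒m<n∨m≡n l≤l′)
      where
        ys<ρ′ : y l′ s < ρ l′
        ys<ρ′ = index⇒below-root l′ s (<-≤-trans s<ρ (root-mono l≤l′))
        crossing-231 : toℕ l < toℕ l′ → ⊥
        crossing-231 l<l′ = avoids-231
          (l , l′ , suc s , zero , suc t , l<l′
          , below-root l s<ρ , above-root l ρ≤t , punchIn-mono-< (ρ l′) yt<ys , punchIn-below ys<ρ′)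
        same-row : toℕ l ≡ toℕ l′ → ⊥
        same-row l≡l′ =
          <⇒≱ (below-root⇒index l′ t (<-trans yt<ys ys<ρ′)) (subst (λ u → ρ u ≤ toℕ t) (toℕ-injective l≡l′) ρ≤t)

    block-order : ∀ l l′ {s t} → toℕ s < ρ l → ρ l ≤ toℕ t → y l′ s < y l′ t
    block-order l l′ {s} {t} s<ρ ρ≤t = [ id , ⊥-elim ∘ crossing ]′ (Y.compare l′ (<-≤-trans s<ρ ρ≤t))
      where
        crossing : ¬ y l′ t < y l′ s
        crossing = [ (λ l≤l′ → ¬crossing-later l≤l′ s<ρ ρ≤t) , (λ l′<l → ¬crossing-earlier l′<l s<ρ ρ≤t) ]′
          (≤-<-connex (toℕ l) (toℕ l′))

    root-cut : ∀ l → IsCut y (ρ l)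
    root-cut l l′ t =
        (λ yt<ρ → ≰⇒> λ ρ≤t →
          <⇒≱ yt<ρ (prefix-below⇒≤ (Y.injective l′) (root≤n l) λ s s<ρ → block-order l l′ s<ρ ρ≤t))
      , (λ t<ρ → ≰⇒> λ ρ≤yt →
          <⇒≱ (suffix-above⇒≤ (Y.injective l′) (Y.bounded l′) (≤-<-trans ρ≤yt (Y.bounded l′ t)) λ s ρ≤s →
                 block-order l l′ t<ρ ρ≤s)
              ρ≤yt)

    suc-pred-c : ∀ {k} → k ≤ r → suc (pred (c (suc k))) ≡ c (suc k)
    suc-pred-c k≤r = suc-pred _ {{>-nonZero (<-≤-trans c₁>0 (mono (s≤s z≤n) (s≤s k≤r)))}}

    later-cut : ∀ {k} → k ≤ r → IsCut y (pred (c (suc k)))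
    later-cut k≤r = insertRoot-cut⁻¹ ρ y (λ l → <⇒≤pred (<-≤-trans (root<c₁ l) (mono (s≤s z≤n) (s≤s k≤r))))
      (subst (IsCut (insertRoot ρ y)) (sym (suc-pred-c k≤r)) (cut (s≤s k≤r)))

    c′ : ℕ → ℕ
    c′ = prepend ρ λ k → pred (c (suc k))

    y-cuts : Cuts (d + r) y c′
    y-cuts = record
      { first = root₀
      ; last  = trans (prepend-high d ρ _ r) (cong pred last)
      ; mono  = mono′
      ; cut   = cut′
      }
      where
        mono′ : ∀ {j k} → j ≤ k → k ≤ d + r → c′ j ≤ c′ k
        mono′ {j} {k} j≤k k≤ with split d j | split d k
        ... | low l  | low l′ = subst₂ _≤_ (sym (prepend-low ρ _ l)) (sym (prepend-low ρ _ l′)) (root-mono j≤k)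
        ... | low l  | high k′ = subst₂ _≤_ (sym (prepend-low ρ _ l)) (sym (prepend-high d ρ _ k′))
          (<⇒≤pred (<-≤-trans (root<c₁ l) (mono (s≤s z≤n) (s≤s (+-cancelˡ-≤ d k′ r k≤)))))
        ... | high j′ | low l′ = ⊥-elim (<⇒≱ (toℕ<n l′) (≤-trans (m≤m+n d j′) j≤k))
        ... | high j′ | high k′ = subst₂ _≤_ (sym (prepend-high d ρ _ j′)) (sym (prepend-high d ρ _ k′))
          (pred-mono-≤ (mono (s≤s (+-cancelˡ-≤ d j′ k′ j≤k)) (s≤s (+-cancelˡ-≤ d k′ r k≤))))
        cut′ : ∀ {k} → k ≤ d + r → IsCut y (c′ k)
        cut′ {k} k≤ with split d k
        ... | low l  = subst (IsCut y) (sym (prepend-low ρ _ l)) (root-cut l)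
        ... | high k′ = subst (IsCut y) (sym (prepend-high d ρ _ k′)) (later-cut (+-cancelˡ-≤ d k′ r k≤))

    represents-node : ∀ F → Represents F y c′ → Represents (node F) (insertRoot ρ y) c
    represents-node F (same-coords , same-cuts) = same-coords′ , same-cuts′
      where
        same-root : ∀ l → cuts F (toℕ l) ≡ ρ l
        same-root l = trans (same-cuts (toℕ≤d+ l r)) (prepend-low ρ _ l)
        same-coords′ : coords (node F) ≗ᶜ insertRoot ρ y
        same-coords′ l zero    = same-root l
        same-coords′ l (suc i) = cong₂ punchIn (same-root l) (same-coords l i)
        same-cuts′ : ∀ {k} → k ≤ suc r → cuts (node F) k ≡ c k
        same-cuts′ {zero}  _         = sym first
        same-cuts′ {suc k} (s≤s k≤r) =
          trans (cong suc (trans (same-cuts (+-monoʳ-≤ d k≤r)) (prepend-high d ρ _ k))) (suc-pred-c k≤r)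

  decompose-node : ∀ {n r} {x : Coords (suc n)} {c} → Avoiding x → Cuts (suc r) x c → 0 < c 1
    → (∀ {y : Coords n} {c′} → Avoiding y → Cuts (d + r) y c′ → Σ[ F ∈ Forest n (d + r) ] Represents F y c′)
    → Σ[ F ∈ Forest (suc n) (suc r) ] Represents F x c
  decompose-node {x = x} x-avoiding x-cuts c₁>0 decompose-rest =
    let F , F-represents = decompose-rest y-avoiding y-cuts
        same-coords , same-cuts = represents-node F F-represents
    in node F , (λ l i → trans (same-coords l i) (sym (x≗ l i))) , same-cuts
    where
      x≗ = reinsertRoot x-avoiding
      open RootRemoval {ρ = λ l → x l zero} {y = removeRoot x} (Avoiding-resp x≗ x-avoiding) (Cuts-resp x≗ x-cuts) c₁>0

  decompose : ∀ n r {x : Coords n} {c} → Avoiding x → Cuts r x c → Σ[ F ∈ Forest n r ] Represents F x c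
  decompose zero    zero _ x-cuts = nil , (λ _ ()) , λ { z≤n → sym (Cuts.first x-cuts) }
  decompose (suc n) zero _ x-cuts = ⊥-elim (0≢1+n (trans (sym (Cuts.first x-cuts)) (Cuts.last x-cuts)))
  decompose n (suc r) {c = c} x-avoiding x-cuts with c 1 in c₁≡
  ... | zero =
    let F , same-coords , same-cuts = decompose n r x-avoiding (Cuts-emptyBlock⁻ x-cuts c₁≡)
    in leaf F , same-coords , λ { {zero} _ → sym (Cuts.first x-cuts) ; {suc k} (s≤s k≤r) → same-cuts k≤r }
  decompose zero    (suc r) {c = c} x-avoiding x-cuts | suc _ = ⊥-elim (0≢1+n (trans (sym c₁≡0) c₁≡))
    where
      open Cuts x-cuts
      c₁≡0 : c 1 ≡ 0
      c₁≡0 = n≤0⇒n≡0 (subst (c 1 ≤_) last (mono (s≤s z≤n) ≤-refl))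
  decompose (suc n) (suc r) x-avoiding x-cuts | suc _ =
    decompose-node x-avoiding x-cuts (subst (0 <_) (sym c₁≡) (s≤s z≤n)) (decompose n (d + r))

  -- Tuples of permutations

  coordsOf : ∀ {n} → Tuple d n → Coords n
  coordsOf σ l i = toℕ (coord {d} σ l i)

  coordsOf-injective : ∀ {n} {σ τ : Tuple d n} → coordsOf σ ≗ᶜ coordsOf τ → σ ≡ τ
  coordsOf-injective same = Pointwise-≡⇒≡ (ext λ l → Pointwise-≡⇒≡ (ext λ i → toℕ-injective (same (suc l) i)))

  -- Fin's _<_ compares toℕ, so Contains-21-12 σ is Contains2112 (coordsOf σ) by definition.
  InS⇒Avoiding : ∀ {n} {σ : Tuple d n} → InS {d} σ → Avoiding (coordsOf σ)
  InS⇒Avoiding (σ-perm , ¬2112 , ¬231) = record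
    { row₀        = λ _ → refl
    ; injective   = λ { zero eq → toℕ-injective eq ; (suc l) eq → lookup⁺ σ-perm l (toℕ-injective eq) }
    ; bounded     = λ _ _ → toℕ<n _
    ; avoids-2112 = ¬2112
    ; avoids-231  = ¬231
    }

  Avoiding⇒InS : ∀ {n} {σ : Tuple d n} → Avoiding (coordsOf σ) → InS {d} σ
  Avoiding⇒InS σ-avoiding = lookup⁻ (λ l eq → injective (suc l) (cong toℕ eq)) , avoids-2112 , avoids-231
    where open Avoiding σ-avoiding

  Cuts-singleBlock : ∀ {n} {x : Coords n} → Avoiding x → Cuts 1 x (0 ◃ λ _ → n)
  Cuts-singleBlock {x = x} x-avoiding = record
    { first = refl
    ; last  = refl
    ; mono  = λ { {zero} _ _ → z≤n ; {suc _} {suc _} _ _ → ≤-refl }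
    ; cut   = λ { {zero} _ → IsCut-zero x ; {suc _} _ l i → (λ _ → toℕ<n i) , (λ _ → Avoiding.bounded x-avoiding l i) }
    }

  toTuple : ∀ {n} (x : Coords n) → (∀ l i → x l i < n) → Tuple d n
  toTuple x x<n = tabulate λ l → tabulate λ i → fromℕ< (x<n (suc l) i)

  coordsOf-toTuple : ∀ {n} {x : Coords n} (x-avoiding : Avoiding x) → coordsOf (toTuple x (Avoiding.bounded x-avoiding)) ≗ᶜ x
  coordsOf-toTuple x-avoiding zero    i = sym (Avoiding.row₀ x-avoiding i)
  coordsOf-toTuple x-avoiding (suc l) i = begin
    toℕ (lookup (lookup (tabulate _) l) i)   ≡⟨ cong (λ v → toℕ (lookup v i)) (lookup∘tabulate _ l) ⟩
    toℕ (lookup (tabulate _) i)              ≡⟨ cong toℕ (lookup∘tabulate _ i) ⟩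
    toℕ (fromℕ< _)                           ≡⟨ toℕ-fromℕ< _ ⟩
    _                                        ∎
    where open ≡-Reasoning

  tuple : ∀ {n} → Forest n 1 → Tuple d n
  tuple F = toTuple (coords F) (Avoiding.bounded (forest-avoiding F))

  coordsOf-tuple : ∀ {n} (F : Forest n 1) → coordsOf (tuple F) ≗ᶜ coords F
  coordsOf-tuple F = coordsOf-toTuple (forest-avoiding F)

  tuple-injective : ∀ {n} → Injective _≡_ _≡_ (tuple {n})
  tuple-injective {x = F} {G} eq = forest-injective F G same-coords same-cuts
    where
      same-coords : coords F ≗ᶜ coords G
      same-coords l i = trans (sym (coordsOf-tuple F l i)) (trans (cong (λ σ → coordsOf σ l i) eq) (coordsOf-tuple G l i))
      same-cuts : ∀ {k} → k ≤ 1 → cuts F k ≡ cuts G k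
      same-cuts z≤n       = trans (Cuts.first (forest-cuts F)) (sym (Cuts.first (forest-cuts G)))
      same-cuts (s≤s z≤n) = trans (Cuts.last (forest-cuts F)) (sym (Cuts.last (forest-cuts G)))

  tuple-InS : ∀ {n} (F : Forest n 1) → InS {d} (tuple F)
  tuple-InS F = Avoiding⇒InS (Avoiding-resp (λ l i → sym (coordsOf-tuple F l i)) (forest-avoiding F))

  InS⇒tuple : ∀ {n} {σ : Tuple d n} → InS {d} σ → ∃[ F ] tuple F ≡ σ
  InS⇒tuple {n} σ-InS =
    let F , same-coords , _ = decompose n 1 σ-avoiding (Cuts-singleBlock σ-avoiding)
    in F , coordsOf-injective (λ l i → trans (coordsOf-tuple F l i) (same-coords l i))
    where σ-avoiding = InS⇒Avoiding σ-InS

  InS-card : ∀ n → HasCard (InS {d} {n}) (forestCount n 1)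
  InS-card n = subst (HasCard InS) (length-forests n 1)
    (HasCard-image tuple tuple-injective (forests-unique n 1) ∈-forests tuple-InS InS⇒tuple)

-- The argument works for every d ≥ 1; the hypothesis 2 ≤ d only excludes d = 0.
corollary2 : (d : ℕ) → 2 ≤ d → (n : ℕ) →
    HasCard (InS {d} {n}) (((d * n + 1) C n) / suc (d * n))
corollary2 (suc e) _ n = subst (HasCard InS) (forestCount-formula e n) (InS-card e n)
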